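{- Let $PF$ be any nonempty parking function. There is exactly one choice of a parking function $PF'$, a car $c$ and an integer $k$ such that the insertion $\operatorname{Insert}(PF',c,k)$ is defined (i.e. $c$ is not a car of $PF'$, the $(k+1)$-diagonal of $PF'$ is empty, and the $k$-diagonal of $PF'$ contains no car smaller than $c$) and $PF \in \operatorname{Insert}(PF',c,k)$. In particular, $k$ is the number of the highest non-empty diagonal of $PF$, $c$ is the smallest car in the $k$-diagonal of $PF$, and $PF' = \rho_c(PF)$.
   Context: A Dyck path of size $n$ is a lattice path from $(0,0)$ to $(n,n)$ with unit North steps $(0,1)$ and East steps $(1,0)$ staying weakly above the line $y=x$. A parking function of size $n$ is a Dyck path of size $n$ together with $n$ distinct positive integers ("cars"), one placed in the unit cell immediately to the right of each North step, such that cars increase from bottom to top within each column. The cell with lower-left corner $(i,j)$ lies in the $(j-i)$-diagonal; a car lies in the diagonal of its cell. The empty parking function (size $0$) is allowed. Insertion $\operatorname{Insert}(PF,c,k)$: let $PF$ be a parking function, $c$ a car not in $PF$, and $k\ge 0$ such that the $(k+1)$-diagonal of $PF$ is empty and the $k$-diagonal of $PF$ contains no car smaller than $c$. $\operatorname{Insert}(PF,c,k)$ is the set of parking functions obtained in each of the following ways: (1) for each car $s<c$ in the $(k-1)$-diagonal: move all cars in rows higher than $s$ up and to the right by one, and place $c$ directly above $s$ (i.e. insert the steps $N E$ into the path immediately after the North step of $s$, with $c$ next to the new North step); (2) for each car $b>c$ in the $k$-diagonal: move all cars in rows higher than $b$ up and to the right by one, and place $c$ directly above and to the right of $b$ (i.e.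 insert the steps $E N$ immediately after the North step of $b$, with $c$ next to the new North step); (3) if $k=0$: move all cars up and to the right by one and place $c$ in the lower-left corner cell (i.e. prepend $N E$ to the path, with $c$ next to the new North step). For a parking function $PF$ and a car $c$ in its highest non-empty diagonal, $\rho_c(PF)$ is the parking function obtained by deleting $c$ and shifting all cars in higher rows down and to the left by one. -}

module Defs where

open import Data.Nat using (ℕ; zero; suc; _<_; _≤_; _≟_)
open import Data.List using (List; []; _∷_; _++_)
open import Data.List.Relation.Unary.All using (All)
open import Data.List.Relation.Unary.Unique.Propositional using (Unique)
open import Data.List.Membership.Propositional using (_∈_; _∉_)
open import Data.Product using (Σ; ∃; _×_; _,_)
open import Data.Sum using (_⊎_)
open import Data.Empty using (⊥)
open import Data.Unit using (⊤)
open import Relation.Nullary using (¬_; yes; no)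
open import Relation.Binary.PropositionalEquality using (_≡_)

-- A lattice path is a word in North / East steps.  A North step carries
-- the car placed in the cell immediately to its right.
data Step : Set where
  N : ℕ → Step
  E : Step

-- Underlying unlabelled step (for reference).
-- Dyck condition: starting at height h = y - x, never go below the line
-- y = x, and end on it (i.e. at (n,n)).
DyckFrom : ℕ → List Step → Set
DyckFrom zero    []          = ⊤
DyckFrom (suc h) []          = ⊥
DyckFrom h       (N _ ∷ w)   = DyckFrom (suc h) w
DyckFrom zero    (E ∷ w)     = ⊥
DyckFrom (suc h) (E ∷ w)     = DyckFrom h w

IsDyck : List Step → Set
IsDyck = DyckFrom 0

cars : List Step → List ℕ
cars []        = []
cars (N c ∷ w) = c ∷ cars w
cars (E ∷ w)   = cars w

-- Cars increase from bottom to top within each column: two North steps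
-- are in the same column exactly when they are consecutive in the word.
ColumnIncreasing : List Step → Set
ColumnIncreasing []               = ⊤
ColumnIncreasing (N c ∷ N d ∷ w)  = c < d × ColumnIncreasing (N d ∷ w)
ColumnIncreasing (N c ∷ E ∷ w)    = ColumnIncreasing (E ∷ w)
ColumnIncreasing (N c ∷ [])       = ⊤
ColumnIncreasing (E ∷ w)          = ColumnIncreasing w

record IsPF (w : List Step) : Set where
  field
    dyck     : IsDyck w
    distinct : Unique (cars w)
    positive : All (1 ≤_) (cars w)
    columns  : ColumnIncreasing w

-- (car , diagonal) pairs.  Before a North step starting at point (x,y)
-- the current height is h = y - x; the car's cell has lower-left corner
-- (x,y), so the car lies in the (y - x)-diagonal = h.
carDiagsFrom : ℕ → List Step → List (ℕ × ℕ)
carDiagsFrom h []        = []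
carDiagsFrom h (N c ∷ w) = (c , h) ∷ carDiagsFrom (suc h) w
carDiagsFrom zero (E ∷ w)    = carDiagsFrom zero w
carDiagsFrom (suc h) (E ∷ w) = carDiagsFrom h w

InDiag : List Step → ℕ → ℕ → Set
InDiag w k c = (c , k) ∈ carDiagsFrom 0 w

DiagEmpty : List Step → ℕ → Set
DiagEmpty w k = ∀ c → ¬ InDiag w k c

IsHighestDiag : List Step → ℕ → Set
IsHighestDiag w k = (∃ λ c → InDiag w k c) × (∀ j → k < j → DiagEmpty w j)

IsSmallestInDiag : List Step → ℕ → ℕ → Set
IsSmallestInDiag w k c = InDiag w k c × (∀ d → InDiag w k d → c ≤ d)

insertAfter : ℕ → List Step → List Step → List Step
insertAfter x seg []        = []
insertAfter x seg (N d ∷ w) with x ≟ d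
... | yes _ = N d ∷ (seg ++ w)
... | no  _ = N d ∷ insertAfter x seg w
insertAfter x seg (E ∷ w)   = E ∷ insertAfter x seg w

InsertDefined : List Step → ℕ → ℕ → Set
InsertDefined w c k =
  IsPF w × 1 ≤ c × c ∉ cars w × DiagEmpty w (suc k) × (∀ d → InDiag w k d → ¬ d < c)

InInsert : List Step → ℕ → ℕ → List Step → Set
InInsert w c k v =
    (Σ ℕ λ k' → k ≡ suc k' × (∃ λ s → s < c × InDiag w k' s × v ≡ insertAfter s (N c ∷ E ∷ []) w))
  ⊎ (∃ λ b → c < b × InDiag w k b × v ≡ insertAfter b (E ∷ N c ∷ []) w)
  ⊎ (k ≡ 0 × v ≡ N c ∷ E ∷ w)

-- ρ_c : delete the North step of c together with the East step right
-- after it (for c in the highest diagonal that step is always E); this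
-- removes c and shifts every later step down-left by one.
dropE : List Step → List Step
dropE (E ∷ w) = w
dropE w       = w

ρ : ℕ → List Step → List Step
ρ c []        = []
ρ c (N d ∷ w) with c ≟ d
... | yes _ = dropE w
... | no  _ = N d ∷ ρ c w
ρ c (E ∷ w)   = E ∷ ρ c w

ValidChoice : List Step → ℕ → ℕ → List Step → Set
ValidChoice w' c k v = InsertDefined w' c k × InInsert w' c k v

module Submission where

-- After basic facts on car diagonals and on ρ, module TopCar shows that
-- deleting such a car c leaves a parking function, and that a walk along PF
-- finds the steps below c: c comes first (rule 3), sits right above a smaller
-- car (rule 1), or above and right of a larger car of its diagonal (rule 2).  Conversely, each rule adds only the car c, in the
-- k-diagonal, and ρ_c undoes it; the insertion conditions on PF' then force
-- k and c to be the highest diagonal of PF and its least car, so the choice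
-- is unique.  Words are read from an arbitrary height h, so that all lemmas
-- are proved by structural recursion on the word.

open import Defs
open import Data.Nat using (ℕ; zero; suc; _<_; _≤_; _≟_; z≤n; s≤s; pred)
open import Data.Nat.Properties
  using (≤-antisym; n≤1+n; 1+n≰n; <⇒≢; ≤⇒≯; ≮⇒≥; ≤∧≢⇒<; <-cmp; ≤-refl; ≤-trans; <-trans; ≤-totalOrder)
open import Data.List using (List; []; _∷_; _++_; filter)
open import Data.List.Membership.Propositional using (_∈_; _∉_)
open import Data.List.Membership.Propositional.Properties using (∈-filter⁺; ∈-filter⁻)
open import Data.List.Relation.Unary.Any using (here; there)
open import Data.List.Relation.Unary.All using (All; lookup; tabulate; _∷_)
open import Data.List.Relation.Unary.AllPairs using (_∷_)
open import Data.List.Relation.Unary.Unique.Propositional using (Unique)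
open import Data.List.Extrema ≤-totalOrder
  using (argmax; argmin; argmax-all; argmin-all; f[xs]≤f[argmax]; f[argmin]≤f[xs])
open import Data.Product using (Σ; ∃; ∃₂; _×_; _,_; proj₁; proj₂)
open import Data.Sum using (_⊎_; inj₁; inj₂)
open import Data.Empty using (⊥-elim)
open import Data.Unit using (⊤; tt)
open import Relation.Nullary using (¬_; Dec; yes; no)
open import Relation.Binary using (tri<; tri≈; tri>)
open import Relation.Binary.PropositionalEquality
  using (_≡_; _≢_; refl; sym; trans; cong; subst)

CarAt : ℕ → List Step → ℕ → ℕ → Set
CarAt h w d j = (d , j) ∈ carDiagsFrom h w

segAbove segAboveRight : ℕ → List Step
segAbove c      = N c ∷ E ∷ []
segAboveRight c = E ∷ N c ∷ []

ρ-hit : ∀ c w → ρ c (N c ∷ w) ≡ dropE w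
ρ-hit c w with c ≟ c
... | yes _  = refl
... | no c≢c = ⊥-elim (c≢c refl)

ρ-miss : ∀ {c d} w → c ≢ d → ρ c (N d ∷ w) ≡ N d ∷ ρ c w
ρ-miss {c} {d} w c≢d with c ≟ d
... | yes c≡d = ⊥-elim (c≢d c≡d)
... | no _    = refl

insertAfter-hit : ∀ s seg w → insertAfter s seg (N s ∷ w) ≡ N s ∷ (seg ++ w)
insertAfter-hit s seg w with s ≟ s
... | yes _  = refl
... | no s≢s = ⊥-elim (s≢s refl)

insertAfter-miss : ∀ {s d} seg w → s ≢ d → insertAfter s seg (N d ∷ w) ≡ N d ∷ insertAfter s seg w
insertAfter-miss {s} {d} seg w s≢d with s ≟ d
... | yes s≡d = ⊥-elim (s≢d s≡d)
... | no _    = refl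

-- A North step raises the height by one.  (DyckFrom h (N x ∷ w) reduces only
-- once h is known to be zero or a successor, hence these two conversions.)
dyck-tail : ∀ {h x w} → DyckFrom h (N x ∷ w) → DyckFrom (suc h) w
dyck-tail {zero}  d = d
dyck-tail {suc h} d = d

dyck-cons : ∀ {h x w} → DyckFrom (suc h) w → DyckFrom h (N x ∷ w)
dyck-cons {zero}  d = d
dyck-cons {suc h} d = d

carAt⇒car : ∀ {h w d j} → CarAt h w d j → d ∈ cars w
carAt⇒car {h}     {N e ∷ w} (here refl) = here refl
carAt⇒car {h}     {N e ∷ w} (there p)   = there (carAt⇒car {suc h} {w} p)
carAt⇒car {zero}  {E ∷ w}   p           = carAt⇒car {zero} {w} p
carAt⇒car {suc h} {E ∷ w}   p           = carAt⇒car {h} {w} p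

carAt-unique : ∀ {h w c j j'} → Unique (cars w) → CarAt h w c j → CarAt h w c j' → j ≡ j'
carAt-unique {h} {N e ∷ w} _ (here refl) (here refl) = refl
carAt-unique {h} {N e ∷ w} (e∉ ∷ _) (here refl) (there q) = ⊥-elim (lookup e∉ (carAt⇒car {suc h} {w} q) refl)
carAt-unique {h} {N e ∷ w} (e∉ ∷ _) (there p) (here refl) = ⊥-elim (lookup e∉ (carAt⇒car {suc h} {w} p) refl)
carAt-unique {h} {N e ∷ w} (_ ∷ u) (there p) (there q) = carAt-unique {suc h} {w} u p q
carAt-unique {zero}  {E ∷ w} u p q = carAt-unique {zero} {w} u p q
carAt-unique {suc h} {E ∷ w} u p q = carAt-unique {h} {w} u p q

carAt-tail : ∀ {h e w d j} → d ≢ e → CarAt h (N e ∷ w) d j → CarAt (suc h) w d j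
carAt-tail d≢e (here refl) = ⊥-elim (d≢e refl)
carAt-tail _   (there p)   = p

diagonal-reached : ∀ {h m} w {d j} → h ≤ m → m ≤ j → CarAt h w d j → ∃ λ e → CarAt h w e m
diagonal-reached {h} (N e ∷ w) h≤m m≤j (here refl) = e , here (cong (e ,_) (≤-antisym m≤j h≤m))
diagonal-reached {h} {m} (N e ∷ w) h≤m m≤j (there p) with h ≟ m
... | yes h≡m = e , here (cong (e ,_) (sym h≡m))
... | no h≢m  = let (e' , q) = diagonal-reached w (≤∧≢⇒< h≤m h≢m) m≤j p in e' , there q
diagonal-reached {zero}  (E ∷ w) h≤m m≤j p = diagonal-reached w h≤m m≤j p
diagonal-reached {suc h} (E ∷ w) h≤m m≤j p = diagonal-reached w (≤-trans (n≤1+n h) h≤m) m≤j p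

-- At height h+1 with diagonal h+1 empty, a Dyck path must step East next: it
-- cannot end there, and a North step would put a car in diagonal h+1.
east-next : ∀ {h} w → DyckFrom (suc h) w → (∀ e → ¬ CarAt (suc h) w e (suc h)) → ∃ λ r → w ≡ E ∷ r
east-next []        ()
east-next (N e ∷ w) _ empty = ⊥-elim (empty e (here refl))
east-next (E ∷ r)   _ _     = r , refl

colInc-tail : ∀ x w → ColumnIncreasing (x ∷ w) → ColumnIncreasing w
colInc-tail (N c) []        _   = tt
colInc-tail (N c) (N d ∷ w) col = proj₂ col
colInc-tail (N c) (E ∷ w)   col = col
colInc-tail E     w         col = col

-- StartsAbove e w : if w begins with a North step, its car exceeds e; this is
-- exactly what N e ∷ w needs besides w being column-increasing.
StartsAbove : ℕ → List Step → Set
StartsAbove e (N f ∷ _) = e < f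
StartsAbove e _         = ⊤

colInc-cons : ∀ e w → StartsAbove e w → ColumnIncreasing w → ColumnIncreasing (N e ∷ w)
colInc-cons e []        _   _   = tt
colInc-cons e (N f ∷ w) e<f col = e<f , col
colInc-cons e (E ∷ w)   _   col = col

cars-dropE : ∀ w → cars (dropE w) ≡ cars w
cars-dropE []        = refl
cars-dropE (N x ∷ w) = refl
cars-dropE (E ∷ w)   = refl

ρ-all : ∀ {P : ℕ → Set} c w → All P (cars w) → All P (cars (ρ c w))
ρ-all c []        ps = ps
ρ-all c (E ∷ w)   ps = ρ-all c w ps
ρ-all c (N d ∷ w) (p ∷ ps) with c ≟ d
... | yes refl = subst (All _) (sym (cars-dropE w)) ps
... | no _     = p ∷ ρ-all c w ps

ρ-unique : ∀ c w → Unique (cars w) → Unique (cars (ρ c w))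
ρ-unique c []        u = u
ρ-unique c (E ∷ w)   u = ρ-unique c w u
ρ-unique c (N d ∷ w) (d∉ ∷ u) with c ≟ d
... | yes refl = subst Unique (sym (cars-dropE w)) u
... | no _     = ρ-all c w d∉ ∷ ρ-unique c w u

ρ-deletes : ∀ c w → Unique (cars w) → c ∉ cars (ρ c w)
ρ-deletes c []        u ()
ρ-deletes c (E ∷ w)   u p = ρ-deletes c w u p
ρ-deletes c (N d ∷ w) (d∉ ∷ u) p with c ≟ d
... | yes refl = lookup d∉ (subst (c ∈_) (cars-dropE w) p) refl
... | no c≢d with p
...   | here c≡d = c≢d c≡d
...   | there q  = ρ-deletes c w u q

ρ-cut : ∀ c u r → c ∉ cars u → ρ c (u ++ N c ∷ E ∷ r) ≡ u ++ r
ρ-cut c []        r _  = ρ-hit c (E ∷ r)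
ρ-cut c (E ∷ u)   r c∉ = cong (E ∷_) (ρ-cut c u r c∉)
ρ-cut c (N d ∷ u) r c∉ =
  trans (ρ-miss (u ++ N c ∷ E ∷ r) (λ c≡d → c∉ (here c≡d))) (cong (N d ∷_) (ρ-cut c u r (λ p → c∉ (there p))))

-- Removing a least car c of the highest diagonal k

module TopCar (c k : ℕ) where

  Below : ℕ → List Step → Set
  Below h w = ∀ d j → CarAt h w d j → j ≤ k

  OnTop : ℕ → List Step → Set
  OnTop h w = ∀ j → CarAt h w c j → j ≡ k

  Least : ℕ → List Step → Set
  Least h w = ∀ d → CarAt h w d k → c ≤ d

  below-tail : ∀ {h e w} → Below h (N e ∷ w) → Below (suc h) w
  below-tail hi d j p = hi d j (there p)

  onTop-tail : ∀ {h e w} → OnTop h (N e ∷ w) → OnTop (suc h) w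
  onTop-tail top j p = top j (there p)

  least-tail : ∀ {h e w} → Least h (N e ∷ w) → Least (suc h) w
  least-tail least d p = least d (there p)

  -- The car c on the highest diagonal is followed by an East step, since
  -- a North step would put the next car in diagonal k+1.
  east-after-c : ∀ {h} w → DyckFrom h (N c ∷ w) → Below h (N c ∷ w) → h ≡ k → ∃ λ r → w ≡ E ∷ r
  east-after-c {h} w dy hi refl = east-next w (dyck-tail {h} {c} dy) (λ e p → 1+n≰n (hi e _ (there p)))

  ρ-sub : ∀ {h} w → DyckFrom h w → Below h w → OnTop h w → ∀ {d j} → CarAt h (ρ c w) d j → CarAt h w d j
  ρ-sub []      _  _  _   p = p
  ρ-sub {zero}  (E ∷ w) () _ _
  ρ-sub {suc h} (E ∷ w) dy hi top p = ρ-sub w dy hi top p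
  ρ-sub {h} (N e ∷ w) dy hi top p with c ≟ e
  ... | yes refl with east-after-c w dy hi (top h (here refl))
  ...   | _ , refl = there p
  ρ-sub {h} (N e ∷ w) dy hi top p | no _ with p
  ...   | here eq = here eq
  ...   | there q = there (ρ-sub w (dyck-tail {h} {e} dy) (below-tail {h} {e} {w} hi) (onTop-tail {h} {e} {w} top) q)

  ρ-dyck : ∀ {h} w → DyckFrom h w → Below h w → OnTop h w → DyckFrom h (ρ c w)
  ρ-dyck []      dy _ _ = dy
  ρ-dyck {zero}  (E ∷ w) () _ _
  ρ-dyck {suc h} (E ∷ w) dy hi top = ρ-dyck w dy hi top
  ρ-dyck {h} (N e ∷ w) dy hi top with c ≟ e
  ... | yes refl with east-after-c w dy hi (top h (here refl))
  ...   | r , refl = dyck-tail {h} {c} {E ∷ r} dy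
  ρ-dyck {h} (N e ∷ w) dy hi top | no _ =
    dyck-cons {h} {e} (ρ-dyck w (dyck-tail {h} {e} dy) (below-tail {h} {e} {w} hi) (onTop-tail {h} {e} {w} top))

  -- After deleting N c E, the car t that followed joins the column of the car
  -- e below c.  Both t and c lie in the k-diagonal, so e < c < t.
  startsAbove-after-c : ∀ {h} e r → suc h ≡ k → Least (suc h) (N c ∷ E ∷ r) → Unique (cars (N c ∷ E ∷ r))
                        → e < c → StartsAbove e r
  startsAbove-after-c e []        _    _     _        _   = tt
  startsAbove-after-c e (E ∷ r)   _    _     _        _   = tt
  startsAbove-after-c {h} e (N t ∷ r) refl least (c∉ ∷ _) e<c =
    <-trans e<c (≤∧≢⇒< (least t (there (here refl))) (lookup c∉ (here refl)))

  ρ-startsAbove : ∀ {h} e w → DyckFrom (suc h) w → Below (suc h) w → OnTop (suc h) w → Least (suc h) w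
                  → Unique (cars w) → ColumnIncreasing (N e ∷ w) → StartsAbove e (ρ c w)
  ρ-startsAbove e []        _  _  _   _     _ _   = tt
  ρ-startsAbove e (E ∷ w)   _  _  _   _     _ _   = tt
  ρ-startsAbove {h} e (N f ∷ w) dy hi top least u col with c ≟ f
  ... | no _     = proj₁ col
  ... | yes refl with east-after-c w dy hi (top (suc h) (here refl))
  ...   | r , refl = startsAbove-after-c e r (top (suc h) (here refl)) least u (proj₁ col)

  ρ-colInc : ∀ {h} w → DyckFrom h w → Below h w → OnTop h w → Least h w → Unique (cars w)
             → ColumnIncreasing w → ColumnIncreasing (ρ c w)
  ρ-colInc []      _  _ _ _ _ _ = tt
  ρ-colInc {zero}  (E ∷ w) () _ _ _ _ _
  ρ-colInc {suc h} (E ∷ w) dy hi top least u col = ρ-colInc w dy hi top least u col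
  ρ-colInc {h} (N e ∷ w) dy hi top least u col with c ≟ e
  ... | yes refl with east-after-c w dy hi (top h (here refl))
  ...   | r , refl = col
  ρ-colInc {h} (N e ∷ w) dy hi top least (_ ∷ u) col | no _ =
    colInc-cons e (ρ c w)
      (ρ-startsAbove e w dy' hi' top' least' u col)
      (ρ-colInc w dy' hi' top' least' u (colInc-tail (N e) w col))
    where
      dy'    = dyck-tail {h} {e} {w} dy
      hi'    = below-tail {h} {e} {w} hi
      top'   = onTop-tail {h} {e} {w} top
      least' = least-tail {h} {e} {w} least

  ρ-isPF : ∀ w → IsPF w → Below 0 w → OnTop 0 w → Least 0 w → IsPF (ρ c w)
  ρ-isPF w pf hi top least = record
    { dyck     = ρ-dyck w dyck hi top
    ; distinct = ρ-unique c w distinct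
    ; positive = ρ-all c w positive
    ; columns  = ρ-colInc w dyck hi top least distinct columns
    }
    where open IsPF pf

  InsertedFrom : ℕ → List Step → List Step → Set
  InsertedFrom h w' v =
      (Σ ℕ λ k' → k ≡ suc k' × ∃ λ s → s < c × CarAt h w' s k' × v ≡ insertAfter s (segAbove c) w')
    ⊎ (∃ λ b → c < b × CarAt h w' b k × v ≡ insertAfter b (segAboveRight c) w')

  inserted-east : ∀ {h w' v} → InsertedFrom h w' v → InsertedFrom (suc h) (E ∷ w') (E ∷ v)
  inserted-east (inj₁ (k' , eq , s , s<c , p , refl)) = inj₁ (k' , eq , s , s<c , p , refl)
  inserted-east (inj₂ (b , c<b , p , refl))           = inj₂ (b , c<b , p , refl)

  inserted-north : ∀ {h w' v e} → e ∉ cars w' → InsertedFrom (suc h) w' v → InsertedFrom h (N e ∷ w') (N e ∷ v)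
  inserted-north {h} {w'} {e = e} e∉ (inj₁ (k' , eq , s , s<c , p , refl)) =
    inj₁ (k' , eq , s , s<c , there p ,
          sym (insertAfter-miss (segAbove c) w' λ { refl → e∉ (carAt⇒car {suc h} {w'} p) }))
  inserted-north {h} {w'} {e = e} e∉ (inj₂ (b , c<b , p , refl)) =
    inj₂ (b , c<b , there p ,
          sym (insertAfter-miss (segAboveRight c) w' λ { refl → e∉ (carAt⇒car {suc h} {w'} p) }))

  -- How a suffix w (read from height h ≤ k+1) containing c in diagonal k is
  -- built: by rule (1) or (2) from ρ_c(w), or c is reached within the first
  -- two steps, in which case the step below c lies in the enclosing word.
  data Decomposition (h : ℕ) (w : List Step) : Set where
    inserted    : ∀ {w'} → ρ c w ≡ w' → InsertedFrom h w' w → Decomposition h w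
    carFirst    : h ≡ k → (r : List Step) → w ≡ N c ∷ E ∷ r → Decomposition h w
    eastThenCar : h ≡ suc k → (r : List Step) → w ≡ E ∷ N c ∷ E ∷ r → Decomposition h w

  decompose : ∀ {h} w → DyckFrom h w → Below h w → h ≤ suc k → Least h w → Unique (cars w)
              → ColumnIncreasing w → CarAt h w c k → Decomposition h w
  decompose []      _  _ _ _ _ _ ()
  decompose {zero}  (E ∷ w) () _ _ _ _ _ _
  decompose {suc h} (E ∷ w) dy hi h≤ least u col cAt
    with decompose w dy hi (≤-trans (n≤1+n h) h≤) least u col cAt
  ... | inserted refl ins   = inserted refl (inserted-east {h} {ρ c w} ins)
  ... | carFirst h≡k r refl = eastThenCar (cong suc h≡k) r refl
  ... | eastThenCar refl _ _ = ⊥-elim (1+n≰n h≤)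
  decompose {h} (N e ∷ w) dy hi h≤ least u col cAt with c ≟ e
  ... | yes refl with carAt-unique {h} {N c ∷ w} u (here refl) cAt
  ...   | h≡k with east-after-c w dy hi h≡k
  ...     | r , refl = carFirst h≡k r refl
  decompose {h} (N e ∷ w) dy hi h≤ least (e∉ ∷ u) col cAt | no c≢e
    with decompose w (dyck-tail {h} {e} dy) (below-tail {h} {e} {w} hi) (s≤s (hi e h (here refl)))
                     (least-tail {h} {e} {w} least) u (colInc-tail (N e) w col) (carAt-tail {h} {e} {w} c≢e cAt)
  ... | inserted refl ins =
    inserted (ρ-miss w c≢e) (inserted-north {h} {ρ c w} (λ p → lookup (ρ-all c w e∉) p refl) ins)
  -- c lies directly above e, which is smaller by column-increase: rule (1).
  ... | carFirst sh≡k r refl =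
    inserted (ρ-cut c (N e ∷ []) r c∉e)
      (inj₁ (h , sym sh≡k , e , proj₁ col , here refl , sym (insertAfter-hit e (segAbove c) r)))
    where c∉e : c ∉ e ∷ []
          c∉e (here c≡e) = c≢e c≡e
  -- c lies above and right of e in the same diagonal, so e > c: rule (2).
  ... | eastThenCar sh≡sk r refl =
    inserted (ρ-cut c (N e ∷ E ∷ []) r c∉e)
      (inj₂ (e , ≤∧≢⇒< (least e (eAt {E ∷ N c ∷ E ∷ r})) c≢e , eAt {E ∷ r} , sym (insertAfter-hit e (segAboveRight c) (E ∷ r))))
    where c∉e : c ∉ e ∷ []
          c∉e (here c≡e) = c≢e c≡e
          eAt : ∀ {t} → CarAt h (N e ∷ t) e k
          eAt = here (cong (e ,_) (sym (cong pred sh≡sk)))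

highest : ∀ (xs : List (ℕ × ℕ)) {x} → x ∈ xs → ∃₂ λ c k → (c , k) ∈ xs × ∀ d j → (d , j) ∈ xs → j ≤ k
highest xs {x} x∈xs =
  proj₁ t , proj₂ t , argmax-all proj₂ x∈xs (tabulate (λ p → p)) ,
  λ d j p → lookup (f[xs]≤f[argmax] {f = proj₂} x xs) p
  where
    t : ℕ × ℕ
    t = argmax proj₂ x xs

leastOn : ∀ (xs : List (ℕ × ℕ)) k {c₀} → (c₀ , k) ∈ xs → ∃ λ c → (c , k) ∈ xs × ∀ d → (d , k) ∈ xs → c ≤ d
leastOn xs k {c₀} c₀∈xs = proj₁ m , m∈xs , λ d p → lookup (f[argmin]≤f[xs] {f = proj₁} (c₀ , k) ys) (∈-filter⁺ onK p refl)
  where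
    onK : (a : ℕ × ℕ) → Dec (proj₂ a ≡ k)
    onK a = proj₂ a ≟ k
    ys : List (ℕ × ℕ)
    ys = filter onK xs
    m : ℕ × ℕ
    m = argmin proj₁ (c₀ , k) ys
    m∈xs : (proj₁ m , k) ∈ xs
    m∈xs with ∈-filter⁻ onK {xs = xs} (argmin-all proj₁ (∈-filter⁺ onK c₀∈xs refl) (tabulate (λ p → p)))
    ... | p , onDiag = subst (λ j → (proj₁ m , j) ∈ xs) onDiag p

-- Existence

has-car : ∀ w → IsDyck w → w ≢ [] → ∃ λ x → x ∈ carDiagsFrom 0 w
has-car []        _  nonempty = ⊥-elim (nonempty refl)
has-car (N c ∷ _) _  _        = (c , 0) , here refl
has-car (E ∷ _)   () _

existence : (PF : List Step) → IsPF PF → PF ≢ [] →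
  Σ (List Step) (λ PF' → Σ ℕ λ c → Σ ℕ λ k → ValidChoice PF' c k PF)
existence PF pf nonempty with has-car PF (IsPF.dyck pf) nonempty
... | _ , x∈ with highest (carDiagsFrom 0 PF) x∈
... | _ , k , top , hi with leastOn (carDiagsFrom 0 PF) k top
... | c , cAt , least = ρ c PF , c , k , defined , member
  where
    open IsPF pf
    open TopCar c k
    onTop : OnTop 0 PF
    onTop j p = carAt-unique {0} {PF} distinct p cAt
    sub : ∀ {d j} → CarAt 0 (ρ c PF) d j → CarAt 0 PF d j
    sub = ρ-sub PF dyck hi onTop
    defined : InsertDefined (ρ c PF) c k
    defined = ρ-isPF PF pf hi onTop least
            , lookup positive (carAt⇒car {0} {PF} cAt)
            , ρ-deletes c PF distinct
            , (λ d p → 1+n≰n (hi d (suc k) (sub p)))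
            , (λ d p d<c → ≤⇒≯ (least d (sub p)) d<c)
    member : InInsert (ρ c PF) c k PF
    member with decompose PF dyck hi z≤n least distinct columns cAt
    ... | inserted refl (inj₁ rule1) = inj₁ rule1
    ... | inserted refl (inj₂ rule2) = inj₂ (inj₁ rule2)
    ... | carFirst 0≡k r refl = inj₂ (inj₂ (sym 0≡k , cong (λ w → N c ∷ E ∷ w) (sym (ρ-hit c (E ∷ r)))))
    ... | eastThenCar () _ _

-- Insertion adds exactly the car c, and ρ_c undoes it

-- seg contributes just the car c: read from height h+1 it puts c in
-- diagonal δ h and returns to height h+1.
AddsCar : ℕ → (ℕ → ℕ) → List Step → Set
AddsCar c δ seg = ∀ h w → carDiagsFrom (suc h) (seg ++ w) ≡ (c , δ h) ∷ carDiagsFrom (suc h) w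

segAbove-adds : ∀ c → AddsCar c suc (segAbove c)
segAbove-adds c h w = refl

segAboveRight-adds : ∀ c → AddsCar c (λ h → h) (segAboveRight c)
segAboveRight-adds c h w = refl

insertAfter-places : ∀ {c δ seg} → AddsCar c δ seg → ∀ {h} w {s j} → Unique (cars w) → CarAt h w s j
                     → CarAt h (insertAfter s seg w) c (δ j)
insertAfter-places adds {h} (N d ∷ w) {s} u p with s ≟ d
insertAfter-places {c} {δ} adds {h} (N d ∷ w) _ (here refl) | yes refl =
  there (subst ((c , δ h) ∈_) (sym (adds h w)) (here refl))
insertAfter-places adds {h} (N d ∷ w) (d∉ ∷ _) (there q) | yes refl = ⊥-elim (lookup d∉ (carAt⇒car {suc h} {w} q) refl)
insertAfter-places adds (N d ∷ w) _ (here refl) | no s≢s = ⊥-elim (s≢s refl)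
insertAfter-places adds (N d ∷ w) (_ ∷ u) (there q) | no _ = there (insertAfter-places adds w u q)
insertAfter-places adds {zero}  (E ∷ w) u p = insertAfter-places adds w u p
insertAfter-places adds {suc h} (E ∷ w) u p = insertAfter-places adds w u p

insertAfter-adds-only : ∀ {c δ seg} → AddsCar c δ seg → ∀ {h s} w {d j} → CarAt h (insertAfter s seg w) d j
                        → CarAt h w d j ⊎ d ≡ c
insertAfter-adds-only adds [] ()
insertAfter-adds-only adds {h} {s} (N d' ∷ w) p with s ≟ d'
... | yes refl with p
...   | here eq = inj₁ (here eq)
...   | there q with subst (_ ∈_) (adds h w) q
...     | here eq = inj₂ (cong proj₁ eq)
...     | there q' = inj₁ (there q')
insertAfter-adds-only adds {h} {s} (N d' ∷ w) p | no _ with p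
...   | here eq = inj₁ (here eq)
...   | there q with insertAfter-adds-only adds w q
...     | inj₁ q' = inj₁ (there q')
...     | inj₂ d≡c = inj₂ d≡c
insertAfter-adds-only adds {zero}  (E ∷ w) p = insertAfter-adds-only adds w p
insertAfter-adds-only adds {suc h} (E ∷ w) p = insertAfter-adds-only adds w p

ρ-undoes-above : ∀ {c s} w → c ∉ cars w → ρ c (insertAfter s (segAbove c) w) ≡ w
ρ-undoes-above []      _  = refl
ρ-undoes-above {c} {s} (E ∷ w) c∉ = cong (E ∷_) (ρ-undoes-above {c} {s} w c∉)
ρ-undoes-above {c} {s} (N d ∷ w) c∉ with s ≟ d
... | yes refl = ρ-cut c (N s ∷ []) w λ { (here c≡s) → c∉ (here c≡s) }
... | no _ = trans (ρ-miss (insertAfter s (segAbove c) w) (λ c≡d → c∉ (here c≡d)))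
                   (cong (N d ∷_) (ρ-undoes-above {c} {s} w (λ p → c∉ (there p))))

-- For rule (2) the car b is on the top diagonal k, so an East step follows
-- it and the inserted E N c is completed to E N c E, which ρ_c cuts out.
ρ-undoes-aboveRight : ∀ {c b h k} w → c ∉ cars w → Unique (cars w) → DyckFrom h w → CarAt h w b k
                      → (∀ e → ¬ CarAt h w e (suc k)) → ρ c (insertAfter b (segAboveRight c) w) ≡ w
ρ-undoes-aboveRight []      _ _ _ () _
ρ-undoes-aboveRight {h = zero} (E ∷ w) _ _ () _ _
ρ-undoes-aboveRight {c} {b} {suc h} (E ∷ w) c∉ u dy bAt empty =
  cong (E ∷_) (ρ-undoes-aboveRight {c} {b} {h} w c∉ u dy bAt empty)
ρ-undoes-aboveRight {c} {b} {h} {k} (N d ∷ w) c∉ u dy bAt empty with b ≟ d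
... | yes refl with east-next w (dyck-tail {h} {b} dy) emptyAbove
  where
    emptyAbove : ∀ e → ¬ CarAt (suc h) w e (suc h)
    emptyAbove e p = empty e (there (subst (λ j → CarAt (suc h) w e (suc j)) (carAt-unique {h} {N b ∷ w} u (here refl) bAt) p))
...   | r , refl = ρ-cut c (N b ∷ E ∷ []) r λ { (here c≡b) → c∉ (here c≡b) }
ρ-undoes-aboveRight {c} {b} {h} {k} (N d ∷ w) c∉ (_ ∷ u) dy bAt empty | no b≢d =
  trans (ρ-miss (insertAfter b (segAboveRight c) w) (λ c≡d → c∉ (here c≡d)))
        (cong (N d ∷_) (ρ-undoes-aboveRight {c} {b} {suc h} {k} w (λ p → c∉ (there p)) u (dyck-tail {h} {d} dy)
                          (carAt-tail {h} {d} {w} b≢d bAt) (λ e p → empty e (there p))))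

-- Identification and uniqueness

record Revealed (PF PF' : List Step) (c k : ℕ) : Set where
  field
    c-at   : InDiag PF k c
    others : ∀ {d j} → InDiag PF j d → InDiag PF' j d ⊎ d ≡ c
    undo   : PF' ≡ ρ c PF

reveal : ∀ PF PF' c k → ValidChoice PF' c k PF → Revealed PF PF' c k
reveal PF PF' c k ((pf' , _ , c∉ , _ , _) , inj₁ (_ , refl , s , _ , sAt , refl)) = record
  { c-at   = insertAfter-places (segAbove-adds c) PF' (IsPF.distinct pf') sAt
  ; others = insertAfter-adds-only (segAbove-adds c) PF'
  ; undo   = sym (ρ-undoes-above PF' c∉)
  }
reveal PF PF' c k ((pf' , _ , c∉ , empty , _) , inj₂ (inj₁ (b , _ , bAt , refl))) = record
  { c-at   = insertAfter-places (segAboveRight-adds c) PF' (IsPF.distinct pf') bAt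
  ; others = insertAfter-adds-only (segAboveRight-adds c) PF'
  ; undo   = sym (ρ-undoes-aboveRight PF' c∉ (IsPF.distinct pf') (IsPF.dyck pf') bAt empty)
  }
reveal PF PF' c k (_ , inj₂ (inj₂ (refl , refl))) = record
  { c-at   = here refl
  ; others = λ { (here eq) → inj₂ (cong proj₁ eq) ; (there p) → inj₁ p }
  ; undo   = sym (ρ-hit c (E ∷ PF'))
  }

-- The conditions of Insert(PF', c, k) transfer to PF: the (k+1)-diagonal of
-- PF' is empty, so by gaplessness nothing of PF lies above k; and no car of
-- PF' in the k-diagonal is smaller than c.
identify : ∀ PF → IsPF PF → ∀ PF' c k → ValidChoice PF' c k PF →
           IsHighestDiag PF k × IsSmallestInDiag PF k c × PF' ≡ ρ c PF
identify PF pf PF' c k valid@((_ , _ , _ , empty , noSmaller) , _) =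
  ((c , c-at) , nothingAbove) , (c-at , cLeast) , undo
  where
    open Revealed (reveal PF PF' c k valid)
    nothingAbove : ∀ j → k < j → DiagEmpty PF j
    nothingAbove j k<j d p with others p
    ... | inj₁ q    = let (e , q') = diagonal-reached PF' z≤n k<j q in empty e q'
    ... | inj₂ refl = <⇒≢ k<j (carAt-unique {0} {PF} (IsPF.distinct pf) c-at p)
    cLeast : ∀ d → InDiag PF k d → c ≤ d
    cLeast d p with others p
    ... | inj₁ q    = ≮⇒≥ (noSmaller d q)
    ... | inj₂ refl = ≤-refl

choice-determined : ∀ PF {PF₁ c₁ k₁ PF₂ c₂ k₂} →
  IsHighestDiag PF k₁ × IsSmallestInDiag PF k₁ c₁ × PF₁ ≡ ρ c₁ PF →
  IsHighestDiag PF k₂ × IsSmallestInDiag PF k₂ c₂ × PF₂ ≡ ρ c₂ PF →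
  PF₁ ≡ PF₂ × c₁ ≡ c₂ × k₁ ≡ k₂
choice-determined PF {k₁ = k₁} {k₂ = k₂} ((_ , above₁) , (at₁ , least₁) , PF₁≡) ((_ , above₂) , (at₂ , least₂) , PF₂≡)
  with <-cmp k₁ k₂
... | tri< k₁<k₂ _ _ = ⊥-elim (above₁ k₂ k₁<k₂ _ at₂)
... | tri> _ _ k₂<k₁ = ⊥-elim (above₂ k₁ k₂<k₁ _ at₁)
... | tri≈ _ refl _ with ≤-antisym (least₁ _ at₂) (least₂ _ at₁)
...   | refl = trans PF₁≡ (sym PF₂≡) , refl , refl

proposition3p4 : (PF : List Step) → IsPF PF → PF ≢ [] →
    Σ (List Step) (λ PF' → Σ ℕ λ c → Σ ℕ λ k → ValidChoice PF' c k PF)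
    × (∀ PF₁ c₁ k₁ PF₂ c₂ k₂ → ValidChoice PF₁ c₁ k₁ PF → ValidChoice PF₂ c₂ k₂ PF →
         PF₁ ≡ PF₂ × c₁ ≡ c₂ × k₁ ≡ k₂)
    × (∀ PF' c k → ValidChoice PF' c k PF →
         IsHighestDiag PF k × IsSmallestInDiag PF k c × PF' ≡ ρ c PF)
proposition3p4 PF pf nonempty =
    existence PF pf nonempty
  , (λ PF₁ c₁ k₁ PF₂ c₂ k₂ valid₁ valid₂ →
       choice-determined PF (identify PF pf PF₁ c₁ k₁ valid₁) (identify PF pf PF₂ c₂ k₂ valid₂))
  , identify PF pf
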